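{- Let $\mathcal{CO}$ be the class of cographs and $k\ge 0$ an integer. For all integers $i,j$ with $k+2\leq i,j\leq 2k+2$, we have $R_{k}^{\mathcal{CO}}(i,j)=i+j-k-2$.
   Context: All graphs are finite and simple. A cograph is a graph containing no induced path on four vertices (equivalently, a graph obtainable from single vertices by disjoint unions and complementation). For a graph $G$ and an integer $k\ge 0$, a $k$-sparse $j$-set is a set of exactly $j$ vertices of $G$ inducing a subgraph of maximum degree at most $k$; a $k$-dense $i$-set is a set of exactly $i$ vertices that is $k$-sparse in the complement of $G$. For a graph class $\mathcal{G}$, $R_k^{\mathcal{G}}(i,j)$ is the smallest natural number $n$ such that every graph on $n$ vertices in $\mathcal{G}$ has a $k$-dense $i$-set or a $k$-sparse $j$-set. -}

module Defs where

open import Data.Nat using (ℕ; _≤_; _<_)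
open import Data.Bool using (Bool; true; false; not; _∧_)
open import Data.Fin using (Fin)
open import Data.Fin.Subset using (Subset; _∈_; _∩_; ∣_∣)
open import Data.Vec using (tabulate)
open import Data.Product using (Σ; _×_)
open import Data.Sum using (_⊎_)
open import Data.Empty using (⊥; ⊥-elim)
open import Relation.Nullary using (¬_; does)
open import Relation.Binary.PropositionalEquality using (_≡_; _≢_)
open import Data.Fin using (_≟_)

record Graph (n : ℕ) : Set where
  field
    adj   : Fin n → Fin n → Bool
    adj-irrefl : ∀ v → adj v v ≡ false
    adj-sym    : ∀ u v → adj u v ≡ adj v u
open Graph public

Adj : ∀ {n} → Graph n → Fin n → Fin n → Set
Adj G u v = adj G u v ≡ true

complement : ∀ {n} → Graph n → Graph n
complement {n} G = record
  { adj = cadj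
  ; adj-irrefl = irr
  ; adj-sym = sy
  }
  where
  cadj : Fin n → Fin n → Bool
  cadj u v = not (does (u ≟ v)) ∧ not (adj G u v)
  open import Relation.Nullary using (yes; no)
  open import Relation.Binary.PropositionalEquality using (refl; cong; sym)
  irr : ∀ v → cadj v v ≡ false
  irr v with v ≟ v
  ... | yes _ = refl
  ... | no v≢v = ⊥-elim (v≢v refl)
  sy : ∀ u v → cadj u v ≡ cadj v u
  sy u v with u ≟ v | v ≟ u
  ... | yes _ | yes _ = refl
  ... | no _  | no _  = cong not (adj-sym G u v)
  ... | yes p | no q  = ⊥-elim (q (sym p))
  ... | no p  | yes q = ⊥-elim (p (sym q))

HasInducedP4 : ∀ {n} → Graph n → Set
HasInducedP4 {n} G =
  Σ (Fin n) λ a → Σ (Fin n) λ b → Σ (Fin n) λ c → Σ (Fin n) λ d →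
    (a ≢ b) × (a ≢ c) × (a ≢ d) × (b ≢ c) × (b ≢ d) × (c ≢ d) ×
    Adj G a b × Adj G b c × Adj G c d ×
    ¬ Adj G a c × ¬ Adj G b d × ¬ Adj G a d

IsCograph : ∀ {n} → Graph n → Set
IsCograph G = ¬ HasInducedP4 G

nbhd : ∀ {n} → Graph n → Fin n → Subset n
nbhd G v = tabulate (λ u → adj G v u)

MaxDegInduced≤ : ∀ {n} → Graph n → ℕ → Subset n → Set
MaxDegInduced≤ G k S = ∀ v → v ∈ S → ∣ S ∩ nbhd G v ∣ ≤ k

HasSparseSet : ∀ {n} → Graph n → (k j : ℕ) → Set
HasSparseSet {n} G k j = Σ (Subset n) λ S → (∣ S ∣ ≡ j) × MaxDegInduced≤ G k S

HasDenseSet : ∀ {n} → Graph n → (k i : ℕ) → Set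
HasDenseSet G k i = HasSparseSet (complement G) k i

RamseyProperty : (k i j n : ℕ) → Set
RamseyProperty k i j n =
  (G : Graph n) → IsCograph G → HasDenseSet G k i ⊎ HasSparseSet G k j

RamseyCO≡ : (k i j m : ℕ) → Set
RamseyCO≡ k i j m = RamseyProperty k i j m × (∀ n → n < m → ¬ RamseyProperty k i j n)

-- A cograph on at least two vertices is disconnected or has a disconnected
-- complement: add a vertex v to a disconnection A ∪ B of the others; if v has
-- neighbours in both A and B and misses some vertex, then no edge joins a
-- neighbour and a non-neighbour of v, since it would extend to an induced P4.
-- Upper bound, by induction on the number of vertices: if G = A + B with
-- ∣B∣ ≤ ∣A∣, either ∣B∣ ≤ k + 1 and all of B joins a k-sparse set of A given by
-- induction, or both sides have k + 1 vertices, and any two sets of at most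
-- k + 1 vertices, one in each side, form a k-sparse set; this reaches every size
-- up to 2k + 2.  A disconnected complement is the same with dense and sparse
-- exchanged.
-- Lower bound: the complete bipartite graph with sides of sizes min(n, j − 1) and
-- n − min(n, j − 1) has neither a k-dense i-set nor a k-sparse j-set when
-- n < i + j − k − 2 and i ≤ j + 1; complementation handles the case j + 1 < i.
module Submission where

open import Defs
open import Data.Bool using (true; false; not; _xor_)
open import Data.Bool.Properties using (¬-not; not-involutive; xor-same; xor-comm)
open import Data.Fin using (Fin; zero; suc; _≟_)
open import Data.Fin.Subset
  using (Subset; _∈_; _∉_; _⊆_; _∩_; _∪_; ∁; ⁅_⁆; _-_; ∣_∣; Nonempty; Empty; ⊤; inside; outside)
  renaming (⊥ to ∅)
open import Data.Fin.Subset.Properties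
  using ( x∈p∪q⁺; x∈p∪q⁻; x∈p∩q⁺; x∈p∩q⁻; ⊆-antisym; p⊆q⇒∣p∣≤∣q∣; s⊆s; ⊥⊆; ∣⊥∣≡0; ∣⊤∣≡n
        ; x∈⁅x⁆; x∈⁅y⁆⇒x≡y; ∣⁅x⁆∣≡1; x∈p∧x≢y⇒x∈p-y; p─q⊆p; nonempty?; Empty-unique
        ; x∈∁p⇒x∉p; x∉∁p⇒x∈p; ∣∁p∣≡n∸∣p∣; p∪∁p≡⊤; ∩-identityʳ; ∩-distribˡ-∪; ∪-assoc; ∪-comm
        ; ∣p∩q∣≤∣q∣)
open import Data.Nat using (ℕ; zero; suc; _+_; _*_; _∸_; _≤_; _<_; _≤?_; _<?_; z≤n; s≤s)
open import Data.Nat.Properties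
  using ( ≤-refl; ≤-trans; ≤-reflexive; <⇒≤; <⇒≢; <⇒≱; ≰⇒>; ≮⇒≥; ≤-pred; n≤1+n; m≤m+n; m≤n+m
        ; m<m+n; <-≤-trans; +-comm; +-assoc; +-suc; +-identityʳ; +-mono-≤; +-monoˡ-≤; +-monoʳ-≤; +-monoˡ-<
        ; +-cancelʳ-≤; +-cancelˡ-≤; +-cancelʳ-≡; m∸n≤m; m∸n+n≡m; m+[n∸m]≡n; m+n∸m≡n
        ; m≤n+o⇒m∸n≤o; module ≤-Reasoning)
open import Data.Nat.Tactic.RingSolver using (solve-∀)
open import Function using (_∘_)
open import Data.Product using (Σ-syntax; _×_; _,_; proj₁; proj₂)
open import Data.Sum using (_⊎_; inj₁; inj₂; [_,_]′; swap; map; map₁; map₂)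
open import Data.Vec using ([]; _∷_; lookup; here; there)
open import Data.Vec.Properties using (lookup∘tabulate; []=⇒lookup; lookup⇒[]=; tabulate-cong)
open import Relation.Nullary using (¬_; Dec; yes; no; contradiction)
open import Relation.Binary.PropositionalEquality
  using (_≡_; _≢_; refl; sym; trans; cong; cong₂; subst; subst₂; ≢-sym; module ≡-Reasoning)

Disjoint : ∀ {n} → Subset n → Subset n → Set
Disjoint p q = ∀ {x} → x ∈ p → x ∉ q

Disjoint-tail : ∀ {n} {b c} {p q : Subset n} → Disjoint (b ∷ p) (c ∷ q) → Disjoint p q
Disjoint-tail disj x∈p x∈q = disj (there x∈p) (there x∈q)

∣p∪q∣≡∣p∣+∣q∣ : ∀ {n} (p q : Subset n) → Disjoint p q → ∣ p ∪ q ∣ ≡ ∣ p ∣ + ∣ q ∣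
∣p∪q∣≡∣p∣+∣q∣ []            []            _    = refl
∣p∪q∣≡∣p∣+∣q∣ (inside  ∷ p) (inside  ∷ q) disj = contradiction here (disj here)
∣p∪q∣≡∣p∣+∣q∣ (inside  ∷ p) (outside ∷ q) disj = cong suc (∣p∪q∣≡∣p∣+∣q∣ p q (Disjoint-tail disj))
∣p∪q∣≡∣p∣+∣q∣ (outside ∷ p) (inside  ∷ q) disj =
  trans (cong suc (∣p∪q∣≡∣p∣+∣q∣ p q (Disjoint-tail disj))) (sym (+-suc ∣ p ∣ ∣ q ∣))
∣p∪q∣≡∣p∣+∣q∣ (outside ∷ p) (outside ∷ q) disj = ∣p∪q∣≡∣p∣+∣q∣ p q (Disjoint-tail disj)

p≡p∩q∪p∩∁q : ∀ {n} (p q : Subset n) → p ≡ (p ∩ q) ∪ (p ∩ ∁ q)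
p≡p∩q∪p∩∁q p q = begin
  p                    ≡⟨ sym (∩-identityʳ p) ⟩
  p ∩ ⊤                ≡⟨ cong (p ∩_) (sym (p∪∁p≡⊤ q)) ⟩
  p ∩ (q ∪ ∁ q)        ≡⟨ ∩-distribˡ-∪ p q (∁ q) ⟩
  (p ∩ q) ∪ (p ∩ ∁ q)  ∎
  where open ≡-Reasoning

Disjoint-p∩q-p∩∁q : ∀ {n} (p q : Subset n) → Disjoint (p ∩ q) (p ∩ ∁ q)
Disjoint-p∩q-p∩∁q p q x∈p∩q x∈p∩∁q = x∈∁p⇒x∉p (proj₂ (x∈p∩q⁻ p _ x∈p∩∁q)) (proj₂ (x∈p∩q⁻ p q x∈p∩q))

∣p∣≡∣p∩q∣+∣p∩∁q∣ : ∀ {n} (p q : Subset n) → ∣ p ∣ ≡ ∣ p ∩ q ∣ + ∣ p ∩ ∁ q ∣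
∣p∣≡∣p∩q∣+∣p∩∁q∣ p q =
  trans (cong ∣_∣ (p≡p∩q∪p∩∁q p q)) (∣p∪q∣≡∣p∣+∣q∣ (p ∩ q) (p ∩ ∁ q) (Disjoint-p∩q-p∩∁q p q))

Nonempty⇒∣p∣>0 : ∀ {n} {p : Subset n} → Nonempty p → 0 < ∣ p ∣
Nonempty⇒∣p∣>0 {p = p} (x , x∈p) = subst (_≤ ∣ p ∣) (∣⁅x⁆∣≡1 x) (p⊆q⇒∣p∣≤∣q∣ ⁅x⁆⊆p)
  where
  ⁅x⁆⊆p : ⁅ x ⁆ ⊆ p
  ⁅x⁆⊆p y∈⁅x⁆ = subst (_∈ p) (sym (x∈⁅y⁆⇒x≡y x y∈⁅x⁆)) x∈p

∣p∣>0⇒Nonempty : ∀ {n} {p : Subset n} → 0 < ∣ p ∣ → Nonempty p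
∣p∣>0⇒Nonempty {n} {p} ∣p∣>0 with nonempty? p
... | yes ne   = ne
... | no empty = contradiction (trans (cong ∣_∣ (Empty-unique empty)) (∣⊥∣≡0 n)) (≢-sym (<⇒≢ ∣p∣>0))

Empty-∩⇒∉ : ∀ {n} {p q : Subset n} {x} → Empty (p ∩ q) → x ∈ p → x ∉ q
Empty-∩⇒∉ empty x∈p x∈q = empty (_ , x∈p∩q⁺ (x∈p , x∈q))

x∉p-x : ∀ {n} (p : Subset n) x → x ∉ p - x
x∉p-x (_ ∷ p) zero    ()
x∉p-x (_ ∷ p) (suc x) (there x∈p-x) = x∉p-x p x x∈p-x

∉⇒Disjoint-⁅⁆ : ∀ {n} {p : Subset n} {x} → x ∉ p → Disjoint p ⁅ x ⁆
∉⇒Disjoint-⁅⁆ {p = p} x∉p y∈p y∈⁅x⁆ = x∉p (subst (_∈ p) (x∈⁅y⁆⇒x≡y _ y∈⁅x⁆) y∈p)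

p≡p-x∪⁅x⁆ : ∀ {n} {p : Subset n} {x} → x ∈ p → p ≡ (p - x) ∪ ⁅ x ⁆
p≡p-x∪⁅x⁆ {p = p} {x} x∈p = ⊆-antisym split join
  where
  split : p ⊆ (p - x) ∪ ⁅ x ⁆
  split {y} y∈p with y ≟ x
  ... | yes refl = x∈p∪q⁺ (inj₂ (x∈⁅x⁆ x))
  ... | no y≢x   = x∈p∪q⁺ (inj₁ (x∈p∧x≢y⇒x∈p-y y∈p y≢x))
  join : (p - x) ∪ ⁅ x ⁆ ⊆ p
  join y∈ = [ p─q⊆p p ⁅ x ⁆ , (λ y∈⁅x⁆ → subst (_∈ p) (sym (x∈⁅y⁆⇒x≡y x y∈⁅x⁆)) x∈p) ]′
              (x∈p∪q⁻ (p - x) ⁅ x ⁆ y∈)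

∣p-x∣+1≡∣p∣ : ∀ {n} {p : Subset n} {x} → x ∈ p → ∣ p - x ∣ + 1 ≡ ∣ p ∣
∣p-x∣+1≡∣p∣ {p = p} {x} x∈p = begin
  ∣ p - x ∣ + 1               ≡⟨ cong (∣ p - x ∣ +_) (∣⁅x⁆∣≡1 x) ⟨
  ∣ p - x ∣ + ∣ ⁅ x ⁆ ∣       ≡⟨ ∣p∪q∣≡∣p∣+∣q∣ (p - x) ⁅ x ⁆ (∉⇒Disjoint-⁅⁆ (x∉p-x p x)) ⟨
  ∣ (p - x) ∪ ⁅ x ⁆ ∣         ≡⟨ cong ∣_∣ (p≡p-x∪⁅x⁆ x∈p) ⟨
  ∣ p ∣                       ∎
  where open ≡-Reasoning

∣p∣≡1⇒x≡y : ∀ {n} {p : Subset n} {x y} → ∣ p ∣ ≡ 1 → x ∈ p → y ∈ p → y ≡ x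
∣p∣≡1⇒x≡y {p = p} {x} {y} ∣p∣≡1 x∈p y∈p with y ≟ x
... | yes y≡x = y≡x
... | no  y≢x = contradiction ∣p-x∣≡0 (≢-sym (<⇒≢ (Nonempty⇒∣p∣>0 (y , x∈p∧x≢y⇒x∈p-y y∈p y≢x))))
  where
  ∣p-x∣≡0 : ∣ p - x ∣ ≡ 0
  ∣p-x∣≡0 = +-cancelʳ-≡ 1 ∣ p - x ∣ 0 (trans (∣p-x∣+1≡∣p∣ x∈p) ∣p∣≡1)

subset-of-size : ∀ {n} (p : Subset n) m → m ≤ ∣ p ∣ → Σ[ q ∈ Subset n ] q ⊆ p × ∣ q ∣ ≡ m
subset-of-size {n} p zero _ = ∅ , ⊥⊆ , ∣⊥∣≡0 n
subset-of-size (inside ∷ p) (suc m) (s≤s m≤∣p∣) with subset-of-size p m m≤∣p∣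
... | q , q⊆p , ∣q∣≡m = inside ∷ q , s⊆s q⊆p , cong suc ∣q∣≡m
subset-of-size (outside ∷ p) (suc m) m<∣p∣ with subset-of-size p (suc m) m<∣p∣
... | q , q⊆p , ∣q∣≡m = outside ∷ q , s⊆s q⊆p , ∣q∣≡m

adj≡false⇒¬Adj : ∀ {n} (G : Graph n) {x y} → adj G x y ≡ false → ¬ Adj G x y
adj≡false⇒¬Adj G xy≡false xy = contradiction (trans (sym xy) xy≡false) λ ()

module _ {n} (G : Graph n) where

  ∈nbhd⇒Adj : ∀ {v x} → x ∈ nbhd G v → Adj G v x
  ∈nbhd⇒Adj {v} {x} x∈ = trans (sym (lookup∘tabulate (adj G v) x)) ([]=⇒lookup x∈)

  Adj⇒∈nbhd : ∀ {v x} → Adj G v x → x ∈ nbhd G v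
  Adj⇒∈nbhd {v} {x} vx = lookup⇒[]= x (nbhd G v) (trans (lookup∘tabulate (adj G v) x) vx)

  ∉nbhd⇒adj≡false : ∀ {v x} → x ∉ nbhd G v → adj G v x ≡ false
  ∉nbhd⇒adj≡false x∉N = ¬-not (λ vx → x∉N (Adj⇒∈nbhd vx))

  Adj⇒≢ : ∀ {x y} → Adj G x y → x ≢ y
  Adj⇒≢ {x} xy refl = adj≡false⇒¬Adj G (adj-irrefl G x) xy

  Adj-complement⁺ : ∀ {x y} → x ≢ y → adj G x y ≡ false → Adj (complement G) x y
  Adj-complement⁺ {x} {y} x≢y xy∉G with x ≟ y
  ... | yes x≡y = contradiction x≡y x≢y
  ... | no  _   = cong not xy∉G

  Adj⇒complement-false : ∀ {x y} → Adj G x y → adj (complement G) x y ≡ false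
  Adj⇒complement-false {x} {y} xy with x ≟ y
  ... | yes _ = refl
  ... | no  _ = cong not xy

  Adj-complement⁻ : ∀ {x y} → Adj (complement G) x y → ¬ Adj G x y
  Adj-complement⁻ co-xy xy = adj≡false⇒¬Adj (complement G) (Adj⇒complement-false xy) co-xy

  ¬Adj-complement⇒Adj : ∀ {x y} → x ≢ y → ¬ Adj (complement G) x y → Adj G x y
  ¬Adj-complement⇒Adj x≢y ¬co-xy = ¬-not λ xy∉G → ¬co-xy (Adj-complement⁺ x≢y xy∉G)

  adj-complement-involutive : ∀ x y → adj (complement (complement G)) x y ≡ adj G x y
  adj-complement-involutive x y with x ≟ y
  ... | yes refl = sym (adj-irrefl G x)
  ... | no  _    = not-involutive (adj G x y)

  HasSparseSet-complement² : ∀ {k m} → HasSparseSet (complement (complement G)) k m → HasSparseSet G k m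
  HasSparseSet-complement² {k} (S , ∣S∣≡m , sparse) = S , ∣S∣≡m , λ v v∈S →
    subst (λ N → ∣ S ∩ N ∣ ≤ k) (tabulate-cong (adj-complement-involutive v)) (sparse v v∈S)

  complement-cograph : IsCograph G → IsCograph (complement G)
  complement-cograph cograph (a , b , c , d , a≢b , a≢c , a≢d , b≢c , b≢d , c≢d , ab , bc , cd , ¬ac , ¬bd , ¬ad) =
    cograph ( c , a , d , b , ≢-sym a≢c , c≢d , ≢-sym b≢c , a≢d , a≢b , ≢-sym b≢d
            , trans (adj-sym G c a) (¬Adj-complement⇒Adj a≢c ¬ac)
            , ¬Adj-complement⇒Adj a≢d ¬ad
            , trans (adj-sym G d b) (¬Adj-complement⇒Adj b≢d ¬bd)
            , Adj-complement⁻ cd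
            , Adj-complement⁻ ab
            , (λ cb → Adj-complement⁻ bc (trans (adj-sym G b c) cb)) )

record Disconnection {n} (G : Graph n) (U : Subset n) : Set where
  field
    left right     : Subset n
    disjoint       : Disjoint left right
    cover          : U ≡ left ∪ right
    left-nonempty  : Nonempty left
    right-nonempty : Nonempty right
    no-cross-edge  : ∀ {x y} → x ∈ left → y ∈ right → adj G x y ≡ false

  left⊆ : left ⊆ U
  left⊆ x∈ = subst (_ ∈_) (sym cover) (x∈p∪q⁺ (inj₁ x∈))

  right⊆ : right ⊆ U
  right⊆ x∈ = subst (_ ∈_) (sym cover) (x∈p∪q⁺ (inj₂ x∈))

  ∈-cover : ∀ {x} → x ∈ U → x ∈ left ⊎ x ∈ right
  ∈-cover x∈ = x∈p∪q⁻ left right (subst (_ ∈_) cover x∈)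

  ∣U∣≡∣left∣+∣right∣ : ∣ U ∣ ≡ ∣ left ∣ + ∣ right ∣
  ∣U∣≡∣left∣+∣right∣ = trans (cong ∣_∣ cover) (∣p∪q∣≡∣p∣+∣q∣ left right disjoint)

  ∣left∣<∣U∣ : ∣ left ∣ < ∣ U ∣
  ∣left∣<∣U∣ = subst (∣ left ∣ <_) (sym ∣U∣≡∣left∣+∣right∣) (m<m+n ∣ left ∣ (Nonempty⇒∣p∣>0 right-nonempty))

open Disconnection

module _ {n} {G : Graph n} where

  Disconnection-swap : ∀ {U} → Disconnection G U → Disconnection G U
  Disconnection-swap d = record
    { left           = right d
    ; right          = left d
    ; disjoint       = λ x∈r x∈l → disjoint d x∈l x∈r
    ; cover          = trans (cover d) (∪-comm (left d) (right d))
    ; left-nonempty  = right-nonempty d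
    ; right-nonempty = left-nonempty d
    ; no-cross-edge  = λ {x} {y} x∈r y∈l → trans (adj-sym G x y) (no-cross-edge d y∈l x∈r)
    }

  Disconnection-orient : ∀ {U} → Disconnection G U → Σ[ d ∈ Disconnection G U ] ∣ right d ∣ ≤ ∣ left d ∣
  Disconnection-orient d with ∣ right d ∣ ≤? ∣ left d ∣
  ... | yes r≤l = d , r≤l
  ... | no  r≰l = Disconnection-swap d , <⇒≤ (≰⇒> r≰l)

  Disconnection-complement² : ∀ {U} → Disconnection (complement (complement G)) U → Disconnection G U
  Disconnection-complement² d = record
    { left           = left d
    ; right          = right d
    ; disjoint       = disjoint d
    ; cover          = cover d
    ; left-nonempty  = left-nonempty d
    ; right-nonempty = right-nonempty d
    ; no-cross-edge  = λ {x} {y} x∈ y∈ → trans (sym (adj-complement-involutive G x y)) (no-cross-edge d x∈ y∈)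
    }

module _ {n} {W : Subset n} {v : Fin n} (v∉W : v ∉ W) where

  Disconnection-singleton : ∀ {H : Graph n} {w} → ∣ W ∣ ≡ 1 → w ∈ W → adj H w v ≡ false →
    Disconnection H (W ∪ ⁅ v ⁆)
  Disconnection-singleton {H} {w} ∣W∣≡1 w∈W wv∉H = record
    { left           = W
    ; right          = ⁅ v ⁆
    ; disjoint       = ∉⇒Disjoint-⁅⁆ v∉W
    ; cover          = refl
    ; left-nonempty  = w , w∈W
    ; right-nonempty = v , x∈⁅x⁆ v
    ; no-cross-edge  = λ x∈W y∈⁅v⁆ →
        subst₂ (λ x y → adj H x y ≡ false)
               (sym (∣p∣≡1⇒x≡y ∣W∣≡1 w∈W x∈W)) (sym (x∈⁅y⁆⇒x≡y v y∈⁅v⁆)) wv∉H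
    }

  insert-into-singleton : ∀ {G : Graph n} {w} → ∣ W ∣ ≡ 1 → w ∈ W →
    Disconnection G (W ∪ ⁅ v ⁆) ⊎ Disconnection (complement G) (W ∪ ⁅ v ⁆)
  insert-into-singleton {G} {w} ∣W∣≡1 w∈W with adj G w v in wv
  ... | false = inj₁ (Disconnection-singleton ∣W∣≡1 w∈W wv)
  ... | true  = inj₂ (Disconnection-singleton ∣W∣≡1 w∈W (Adj⇒complement-false G wv))

  insert-left : ∀ {G : Graph n} (d : Disconnection G W) → (∀ {y} → y ∈ right d → adj G v y ≡ false) →
    Disconnection G (W ∪ ⁅ v ⁆)
  insert-left {G} d v-right = record
    { left           = L ∪ ⁅ v ⁆
    ; right          = R
    ; disjoint       = λ x∈ x∈R → [ (λ x∈L → disjoint d x∈L x∈R)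
                                  , (λ x∈⁅v⁆ → ∉⇒Disjoint-⁅⁆ v∉W (right⊆ d x∈R) x∈⁅v⁆) ]′ (x∈p∪q⁻ L ⁅ v ⁆ x∈)
    ; cover          = begin
        W ∪ ⁅ v ⁆          ≡⟨ cong (_∪ ⁅ v ⁆) (cover d) ⟩
        (L ∪ R) ∪ ⁅ v ⁆    ≡⟨ ∪-assoc L R ⁅ v ⁆ ⟩
        L ∪ (R ∪ ⁅ v ⁆)    ≡⟨ cong (L ∪_) (∪-comm R ⁅ v ⁆) ⟩
        L ∪ (⁅ v ⁆ ∪ R)    ≡⟨ ∪-assoc L ⁅ v ⁆ R ⟨
        (L ∪ ⁅ v ⁆) ∪ R    ∎
    ; left-nonempty  = proj₁ (left-nonempty d) , x∈p∪q⁺ (inj₁ (proj₂ (left-nonempty d)))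
    ; right-nonempty = right-nonempty d
    ; no-cross-edge  = λ {x} {y} x∈ y∈R →
        [ (λ x∈L → no-cross-edge d x∈L y∈R)
        , (λ x∈⁅v⁆ → subst (λ z → adj G z y ≡ false) (sym (x∈⁅y⁆⇒x≡y v x∈⁅v⁆)) (v-right y∈R)) ]′
        (x∈p∪q⁻ L ⁅ v ⁆ x∈)
    }
    where
    open ≡-Reasoning
    L = left d
    R = right d

  insert-cone : ∀ {G : Graph n} → Nonempty W → (∀ {y} → y ∈ W → Adj G v y) →
    Disconnection (complement G) (W ∪ ⁅ v ⁆)
  insert-cone {G} W-nonempty v-all = record
    { left           = ⁅ v ⁆
    ; right          = W
    ; disjoint       = λ x∈⁅v⁆ x∈W → ∉⇒Disjoint-⁅⁆ v∉W x∈W x∈⁅v⁆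
    ; cover          = ∪-comm W ⁅ v ⁆
    ; left-nonempty  = v , x∈⁅x⁆ v
    ; right-nonempty = W-nonempty
    ; no-cross-edge  = λ {x} {y} x∈⁅v⁆ y∈W →
        subst (λ z → adj (complement G) z y ≡ false) (sym (x∈⁅y⁆⇒x≡y v x∈⁅v⁆))
              (Adj⇒complement-false G (v-all y∈W))
    }

  -- x − y − v − z would be an induced P4.
  non-neighbour-¬Adj-neighbour : ∀ {G : Graph n} → IsCograph G → (d : Disconnection G W) →
    ∀ {x y z} → x ∈ left d → y ∈ left d → z ∈ right d →
    adj G v x ≡ false → Adj G v y → Adj G v z → ¬ Adj G x y
  non-neighbour-¬Adj-neighbour {G} cograph d {x} {y} {z} x∈L y∈L z∈R vx∉G vy vz xy =
    cograph ( x , y , v , z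
            , (λ { refl → adj≡false⇒¬Adj G vx∉G vy })
            , (λ { refl → v∉W (left⊆ d x∈L) })
            , (λ { refl → disjoint d x∈L z∈R })
            , (λ { refl → v∉W (left⊆ d y∈L) })
            , (λ { refl → disjoint d y∈L z∈R })
            , (λ { refl → v∉W (right⊆ d z∈R) })
            , xy , trans (adj-sym G y v) vy , vz
            , adj≡false⇒¬Adj G (trans (adj-sym G x v) vx∉G)
            , adj≡false⇒¬Adj G (no-cross-edge d y∈L z∈R)
            , adj≡false⇒¬Adj G (no-cross-edge d x∈L z∈R) )

  insert-by-neighbourhood : ∀ {G : Graph n} → IsCograph G → (d : Disconnection G W) →
    Nonempty (left d ∩ nbhd G v) → Nonempty (right d ∩ nbhd G v) → Nonempty (W ∩ ∁ (nbhd G v)) →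
    Disconnection G (W ∪ ⁅ v ⁆)
  insert-by-neighbourhood {G} cograph d (l , l∈) (r , r∈) non-neighbour =
    insert-left by-neighbourhood (λ y∈ → ∉nbhd (proj₂ (x∈p∩q⁻ W (∁ N) y∈)))
    where
    N = nbhd G v

    ∉nbhd : ∀ {y} → y ∈ ∁ N → adj G v y ≡ false
    ∉nbhd y∈∁N = ∉nbhd⇒adj≡false G (x∈∁p⇒x∉p y∈∁N)

    neighbour : ∀ {y} {S : Subset n} → y ∈ S ∩ N → Adj G v y
    neighbour {S = S} y∈ = ∈nbhd⇒Adj G (proj₂ (x∈p∩q⁻ S N y∈))

    cross : ∀ {x y} → x ∈ W ∩ N → y ∈ W ∩ ∁ N → adj G x y ≡ false
    cross {x} {y} x∈ y∈ with x∈p∩q⁻ W N x∈ | x∈p∩q⁻ W (∁ N) y∈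
    ... | x∈W , x∈N | y∈W , y∈∁N with ∈-cover d x∈W | ∈-cover d y∈W
    ... | inj₁ x∈L | inj₂ y∈R = no-cross-edge d x∈L y∈R
    ... | inj₂ x∈R | inj₁ y∈L = trans (adj-sym G x y) (no-cross-edge d y∈L x∈R)
    ... | inj₁ x∈L | inj₁ y∈L = ¬-not λ xy →
          non-neighbour-¬Adj-neighbour cograph d y∈L x∈L (proj₁ (x∈p∩q⁻ _ N r∈))
            (∉nbhd y∈∁N) (∈nbhd⇒Adj G x∈N) (neighbour r∈) (trans (adj-sym G y x) xy)
    ... | inj₂ x∈R | inj₂ y∈R = ¬-not λ xy →
          non-neighbour-¬Adj-neighbour cograph (Disconnection-swap d) y∈R x∈R (proj₁ (x∈p∩q⁻ _ N l∈))
            (∉nbhd y∈∁N) (∈nbhd⇒Adj G x∈N) (neighbour l∈) (trans (adj-sym G y x) xy)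

    by-neighbourhood : Disconnection G W
    by-neighbourhood = record
      { left           = W ∩ N
      ; right          = W ∩ ∁ N
      ; disjoint       = Disjoint-p∩q-p∩∁q W N
      ; cover          = p≡p∩q∪p∩∁q W N
      ; left-nonempty  = l , x∈p∩q⁺ (left⊆ d (proj₁ (x∈p∩q⁻ _ N l∈)) , proj₂ (x∈p∩q⁻ _ N l∈))
      ; right-nonempty = non-neighbour
      ; no-cross-edge  = cross
      }

  insert : ∀ {G : Graph n} → IsCograph G → Disconnection G W →
    Disconnection G (W ∪ ⁅ v ⁆) ⊎ Disconnection (complement G) (W ∪ ⁅ v ⁆)
  insert {G} cograph d
    with nonempty? (right d ∩ nbhd G v) | nonempty? (left d ∩ nbhd G v) | nonempty? (W ∩ ∁ (nbhd G v))
  ... | no none-right | _ | _ = inj₁ (insert-left d (λ y∈R → ∉nbhd⇒adj≡false G (Empty-∩⇒∉ none-right y∈R)))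
  ... | yes _ | no none-left | _ = inj₁ (insert-left (Disconnection-swap d) (λ y∈L → ∉nbhd⇒adj≡false G (Empty-∩⇒∉ none-left y∈L)))
  ... | yes _ | yes _ | no none-non-neighbour =
        inj₂ (insert-cone (proj₁ (left-nonempty d) , left⊆ d (proj₂ (left-nonempty d)))
                          (λ y∈W → ∈nbhd⇒Adj G (x∉∁p⇒x∈p (Empty-∩⇒∉ none-non-neighbour y∈W))))
  ... | yes r | yes l | yes m = inj₁ (insert-by-neighbourhood cograph d l r m)

∣p∣≡1+m⇒Nonempty : ∀ {n m} {p : Subset n} → ∣ p ∣ ≡ suc m → Nonempty p
∣p∣≡1+m⇒Nonempty ∣p∣≡1+m = ∣p∣>0⇒Nonempty (subst (0 <_) (sym ∣p∣≡1+m) (s≤s z≤n))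

cograph-decomposition : ∀ {n} {G : Graph n} → IsCograph G → ∀ m (U : Subset n) → ∣ U ∣ ≡ 2 + m →
  Disconnection G U ⊎ Disconnection (complement G) U
cograph-decomposition {G = G} cograph m U ∣U∣≡2+m =
  subst (λ V → Disconnection G V ⊎ Disconnection (complement G) V) (sym (p≡p-x∪⁅x⁆ v∈U)) (extend ∣W∣≡1+m)
  where
  v   = proj₁ (∣p∣≡1+m⇒Nonempty ∣U∣≡2+m)
  v∈U = proj₂ (∣p∣≡1+m⇒Nonempty ∣U∣≡2+m)
  W   = U - v

  ∣W∣≡1+m : ∣ W ∣ ≡ suc m
  ∣W∣≡1+m = +-cancelʳ-≡ 1 ∣ W ∣ (suc m) (trans (∣p-x∣+1≡∣p∣ v∈U) (trans ∣U∣≡2+m (+-comm 1 (suc m))))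

  extend : ∀ {m} → ∣ W ∣ ≡ suc m → Disconnection G (W ∪ ⁅ v ⁆) ⊎ Disconnection (complement G) (W ∪ ⁅ v ⁆)
  extend {zero} ∣W∣≡1 = insert-into-singleton (x∉p-x U v) ∣W∣≡1 (proj₂ (∣p∣≡1+m⇒Nonempty ∣W∣≡1))
  extend {suc m} ∣W∣≡2+m with cograph-decomposition cograph m W ∣W∣≡2+m
  ... | inj₁ d = insert (x∉p-x U v) cograph d
  ... | inj₂ d = swap (map₂ Disconnection-complement² (insert (x∉p-x U v) (complement-cograph G cograph) d))

SparseIn : ∀ {n} → Graph n → ℕ → Subset n → ℕ → Set
SparseIn {n} H k U m = Σ[ S ∈ Subset n ] S ⊆ U × ∣ S ∣ ≡ m × MaxDegInduced≤ H k S

SparseIn⇒HasSparseSet : ∀ {n} {H : Graph n} {k U m} → SparseIn H k U m → HasSparseSet H k m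
SparseIn⇒HasSparseSet (S , _ , ∣S∣≡m , sparse) = S , ∣S∣≡m , sparse

module _ {n} (H : Graph n) (k : ℕ) where

  small⇒MaxDegInduced≤ : ∀ {S} → ∣ S ∣ ≤ suc k → MaxDegInduced≤ H k S
  small⇒MaxDegInduced≤ {S} ∣S∣≤1+k v v∈S = +-cancelʳ-≤ 1 _ _ (begin
      ∣ S ∩ nbhd H v ∣ + 1  ≤⟨ +-monoˡ-≤ 1 (p⊆q⇒∣p∣≤∣q∣ neighbours⊆S-v) ⟩
      ∣ S - v ∣ + 1         ≡⟨ ∣p-x∣+1≡∣p∣ v∈S ⟩
      ∣ S ∣                 ≤⟨ ∣S∣≤1+k ⟩
      suc k                 ≡⟨ +-comm 1 k ⟩
      k + 1                 ∎)
    where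
    open ≤-Reasoning
    neighbours⊆S-v : S ∩ nbhd H v ⊆ S - v
    neighbours⊆S-v x∈ with x∈p∩q⁻ S (nbhd H v) x∈
    ... | x∈S , x∈N = x∈p∧x≢y⇒x∈p-y x∈S (≢-sym (Adj⇒≢ H (∈nbhd⇒Adj H x∈N)))

  neighbours-in-∪ : ∀ {S T v} → (∀ {y} → y ∈ T → adj H v y ≡ false) → (S ∪ T) ∩ nbhd H v ⊆ S ∩ nbhd H v
  neighbours-in-∪ {S} {T} {v} v-T x∈ with x∈p∩q⁻ (S ∪ T) (nbhd H v) x∈
  ... | x∈S∪T , x∈N = x∈p∩q⁺ (in-S (x∈p∪q⁻ S T x∈S∪T) , x∈N)
    where
    in-S : _ ∈ S ⊎ _ ∈ T → _ ∈ S
    in-S (inj₁ x∈S) = x∈S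
    in-S (inj₂ x∈T) = contradiction (∈nbhd⇒Adj H x∈N) (adj≡false⇒¬Adj H (v-T x∈T))

  MaxDegInduced≤-∪ : ∀ {S T} → (∀ {x y} → x ∈ S → y ∈ T → adj H x y ≡ false) →
    MaxDegInduced≤ H k S → MaxDegInduced≤ H k T → MaxDegInduced≤ H k (S ∪ T)
  MaxDegInduced≤-∪ {S} {T} no-cross S-sparse T-sparse v v∈ with x∈p∪q⁻ S T v∈
  ... | inj₁ v∈S = ≤-trans (p⊆q⇒∣p∣≤∣q∣ (neighbours-in-∪ {S} {T} (no-cross v∈S))) (S-sparse v v∈S)
  ... | inj₂ v∈T = ≤-trans (p⊆q⇒∣p∣≤∣q∣ neighbours⊆) (T-sparse v v∈T)
    where
    neighbours⊆ : (S ∪ T) ∩ nbhd H v ⊆ T ∩ nbhd H v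
    neighbours⊆ = subst (λ X → X ∩ nbhd H v ⊆ T ∩ nbhd H v) (∪-comm T S)
                        (neighbours-in-∪ λ {y} y∈S → trans (adj-sym H v y) (no-cross y∈S v∈T))

  SparseIn-mono : ∀ {A U m} → A ⊆ U → SparseIn H k A m → SparseIn H k U m
  SparseIn-mono A⊆U (S , S⊆A , ∣S∣≡m , sparse) = S , (λ x∈S → A⊆U (S⊆A x∈S)) , ∣S∣≡m , sparse

  SparseIn-small : ∀ {U m} → m ≤ ∣ U ∣ → m ≤ suc k → SparseIn H k U m
  SparseIn-small {U} {m} m≤∣U∣ m≤1+k with subset-of-size U m m≤∣U∣
  ... | S , S⊆U , ∣S∣≡m = S , S⊆U , ∣S∣≡m , small⇒MaxDegInduced≤ (subst (_≤ suc k) (sym ∣S∣≡m) m≤1+k)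

  SparseIn-join : ∀ {U a b} (d : Disconnection H U) →
    SparseIn H k (left d) a → SparseIn H k (right d) b → SparseIn H k U (a + b)
  SparseIn-join d (S , S⊆L , ∣S∣≡a , S-sparse) (T , T⊆R , ∣T∣≡b , T-sparse) =
      S ∪ T
    , (λ x∈ → [ (λ x∈S → left⊆ d (S⊆L x∈S)) , (λ x∈T → right⊆ d (T⊆R x∈T)) ]′ (x∈p∪q⁻ S T x∈))
    , trans (∣p∪q∣≡∣p∣+∣q∣ S T (λ x∈S x∈T → disjoint d (S⊆L x∈S) (T⊆R x∈T))) (cong₂ _+_ ∣S∣≡a ∣T∣≡b)
    , MaxDegInduced≤-∪ (λ x∈S y∈T → no-cross-edge d (S⊆L x∈S) (T⊆R y∈T)) S-sparse T-sparse

InRange : ℕ → ℕ → Set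
InRange k j = k + 2 ≤ j × j ≤ 2 * k + 2

2k+2≡[1+k]+[1+k] : ∀ k → 2 * k + 2 ≡ suc k + suc k
2k+2≡[1+k]+[1+k] = solve-∀

[a+r]+c≡[a+c]+r : ∀ a r c → (a + r) + c ≡ (a + c) + r
[a+r]+c≡[a+c]+r = solve-∀

module _ {n} (H : Graph n) (k : ℕ) {U : Subset n} (d : Disconnection H U) (right≤left : ∣ right d ∣ ≤ ∣ left d ∣)
         {i} {Q : Set} (k+2≤i : k + 2 ≤ i)
         (induction : ∀ j → InRange k j → i + j ≤ ∣ left d ∣ + (k + 2) → Q ⊎ SparseIn H k (left d) j) where

  join-step : ∀ j → InRange k j → i + j ≤ ∣ U ∣ + (k + 2) → Q ⊎ SparseIn H k U j
  join-step j (k+2≤j , j≤2k+2) i+j≤∣U∣+c = by-size-of-right (∣ right d ∣ ≤? suc k)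
    where
    a = ∣ left d ∣
    r = ∣ right d ∣
    c = k + 2

    1+k<j : suc k < j
    1+k<j = subst (_≤ j) (+-comm k 2) k+2≤j

    remainder-of-right : r ≤ suc k → Q ⊎ SparseIn H k U j
    remainder-of-right r≤1+k = by-size-of-remainder (k + 2 ≤? j')
      where
      j' = j ∸ r

      j'+r≡j : j' + r ≡ j
      j'+r≡j = m∸n+n≡m (≤-trans r≤1+k (<⇒≤ 1+k<j))

      i+j'≤a+c : i + j' ≤ a + c
      i+j'≤a+c = +-cancelʳ-≤ r (i + j') (a + c) (begin
        (i + j') + r  ≡⟨ +-assoc i j' r ⟩
        i + (j' + r)  ≡⟨ cong (i +_) j'+r≡j ⟩
        i + j         ≤⟨ i+j≤∣U∣+c ⟩
        ∣ U ∣ + c     ≡⟨ cong (_+ c) (∣U∣≡∣left∣+∣right∣ d) ⟩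
        (a + r) + c   ≡⟨ [a+r]+c≡[a+c]+r a r c ⟩
        (a + c) + r   ∎)
        where open ≤-Reasoning

      j'≤a : j' ≤ a
      j'≤a = +-cancelʳ-≤ c j' a (≤-trans (+-monoʳ-≤ j' k+2≤i) (subst (_≤ a + c) (+-comm i j') i+j'≤a+c))

      with-right : SparseIn H k (left d) j' → SparseIn H k U j
      with-right s = subst (SparseIn H k U) j'+r≡j (SparseIn-join H k d s (SparseIn-small H k ≤-refl r≤1+k))

      by-size-of-remainder : Dec (k + 2 ≤ j') → Q ⊎ SparseIn H k U j
      by-size-of-remainder (yes k+2≤j') =
        map₂ with-right (induction j' (k+2≤j' , ≤-trans (m∸n≤m j r) j≤2k+2) i+j'≤a+c)
      by-size-of-remainder (no k+2≰j') =
        inj₂ (with-right (SparseIn-small H k j'≤a (≤-pred (subst (j' <_) (+-comm k 2) (≰⇒> k+2≰j')))))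

    by-size-of-right : Dec (r ≤ suc k) → Q ⊎ SparseIn H k U j
    by-size-of-right (yes r≤1+k) = remainder-of-right r≤1+k
    by-size-of-right (no  r≰1+k) = inj₂ (subst (SparseIn H k U) (m+[n∸m]≡n (<⇒≤ 1+k<j))
      (SparseIn-join H k d (SparseIn-small H k (≤-trans 1+k≤r right≤left) ≤-refl)
                           (SparseIn-small H k (≤-trans rest≤1+k 1+k≤r) rest≤1+k)))
      where
      1+k≤r : suc k ≤ r
      1+k≤r = <⇒≤ (≰⇒> r≰1+k)
      rest≤1+k : j ∸ suc k ≤ suc k
      rest≤1+k = m≤n+o⇒m∸n≤o j (suc k) (subst (j ≤_) (2k+2≡[1+k]+[1+k] k) j≤2k+2)

InRange-sum⇒2≤ : ∀ {k i j s} → InRange k i → InRange k j → i + j ≤ s + (k + 2) → 2 ≤ s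
InRange-sum⇒2≤ {k} {s = s} (k+2≤i , _) (k+2≤j , _) i+j≤s+c =
  ≤-trans (m≤n+m 2 k) (+-cancelʳ-≤ (k + 2) (k + 2) s (≤-trans (+-mono-≤ k+2≤i k+2≤j) i+j≤s+c))

module _ {n} {G : Graph n} (cograph : IsCograph G) (k : ℕ) where

  ramsey-within : ∀ m (U : Subset n) → ∣ U ∣ ≤ m → ∀ i j → InRange k i → InRange k j →
    i + j ≤ ∣ U ∣ + (k + 2) → SparseIn (complement G) k U i ⊎ SparseIn G k U j
  ramsey-within zero U ∣U∣≤0 i j ri rj i+j≤ = contradiction (≤-trans (InRange-sum⇒2≤ ri rj i+j≤) ∣U∣≤0) λ ()
  ramsey-within (suc m) U ∣U∣≤1+m i j ri rj i+j≤
    with cograph-decomposition cograph (∣ U ∣ ∸ 2) U (sym (m+[n∸m]≡n (InRange-sum⇒2≤ ri rj i+j≤)))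
  ... | inj₁ d =
          let d' , r≤l = Disconnection-orient d in
          map₁ (SparseIn-mono (complement G) k (left⊆ d'))
               (join-step G k d' r≤l (proj₁ ri)
                  (λ j' rj' h → ramsey-within m (left d') (≤-pred (≤-trans (∣left∣<∣U∣ d') ∣U∣≤1+m))
                                                i j' ri rj' h)
                  j rj i+j≤)
  ... | inj₂ d =
          let d' , r≤l = Disconnection-orient d in
          swap (map₁ (SparseIn-mono G k (left⊆ d'))
                     (join-step (complement G) k d' r≤l (proj₁ rj)
                        (λ i' ri' h → swap (ramsey-within m (left d') (≤-pred (≤-trans (∣left∣<∣U∣ d') ∣U∣≤1+m))
                                              i' j ri' rj (subst (_≤ ∣ left d' ∣ + (k + 2)) (+-comm j i') h)))
                        i ri (subst (_≤ ∣ U ∣ + (k + 2)) (+-comm i j) i+j≤)))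

cograph-ramsey-upper : ∀ {k i j n} → InRange k i → InRange k j → i + j ≤ n + (k + 2) → RamseyProperty k i j n
cograph-ramsey-upper {k} {i} {j} {n} ri rj i+j≤ G cograph =
  map (SparseIn⇒HasSparseSet {H = complement G}) (SparseIn⇒HasSparseSet {H = G})
      (ramsey-within {G = G} cograph k n ⊤ (≤-reflexive (∣⊤∣≡n n)) i j ri rj
                     (subst (λ s → i + j ≤ s + (k + 2)) (sym (∣⊤∣≡n n)) i+j≤))

module _ {n} (H : Graph n) (k : ℕ) {S : Subset n} (sparse : MaxDegInduced≤ H k S) where

  ∣neighbours∣≤k : ∀ {w T} → w ∈ S → T ⊆ S → (∀ {u} → u ∈ T → Adj H w u) → ∣ T ∣ ≤ k
  ∣neighbours∣≤k {w} w∈S T⊆S w-T =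
    ≤-trans (p⊆q⇒∣p∣≤∣q∣ (λ u∈T → x∈p∩q⁺ (T⊆S u∈T , Adj⇒∈nbhd H (w-T u∈T)))) (sparse w w∈S)

  ∣S∩clique∣≤1+k : ∀ {C} → (∀ {u v} → u ∈ C → v ∈ C → u ≢ v → Adj H u v) → ∣ S ∩ C ∣ ≤ suc k
  ∣S∩clique∣≤1+k {C} clique with nonempty? (S ∩ C)
  ... | no empty = subst (_≤ suc k) (sym (trans (cong ∣_∣ (Empty-unique empty)) (∣⊥∣≡0 n))) z≤n
  ... | yes (v , v∈S∩C) =
        subst (_≤ suc k) (trans (+-comm 1 _) (∣p-x∣+1≡∣p∣ v∈S∩C))
              (s≤s (∣neighbours∣≤k (proj₁ (x∈p∩q⁻ S C v∈S∩C)) (λ u∈ → proj₁ (x∈p∩q⁻ S C (in-S∩C u∈))) adjacent))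
    where
    in-S∩C : ∀ {u} → u ∈ (S ∩ C) - v → u ∈ S ∩ C
    in-S∩C = p─q⊆p (S ∩ C) ⁅ v ⁆
    adjacent : ∀ {u} → u ∈ (S ∩ C) - v → Adj H v u
    adjacent u∈ = clique (proj₂ (x∈p∩q⁻ S C v∈S∩C)) (proj₂ (x∈p∩q⁻ S C (in-S∩C u∈)))
                         (λ { refl → x∉p-x (S ∩ C) v u∈ })

xor-path : ∀ a b c d → a xor b ≡ true → b xor c ≡ true → c xor d ≡ true → a xor d ≡ true
xor-path true  true  _     _     ()   _    _
xor-path false false _     _     ()   _    _
xor-path true  false false _     _    ()   _
xor-path false true  true  _     _    ()   _
xor-path true  false true  true  _    _    ()
xor-path false true  false false _    _    ()
xor-path true  false true  false _    _    _    = refl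
xor-path false true  false true  _    _    _    = refl

completeBipartite : ∀ {n} → Subset n → Graph n
completeBipartite A = record
  { adj        = λ u v → lookup A u xor lookup A v
  ; adj-irrefl = λ v → xor-same (lookup A v)
  ; adj-sym    = λ u v → xor-comm (lookup A u) (lookup A v)
  }

completeBipartite-cograph : ∀ {n} (A : Subset n) → IsCograph (completeBipartite A)
completeBipartite-cograph A (a , b , c , d , _ , _ , _ , _ , _ , _ , ab , bc , cd , _ , _ , ¬ad) =
  ¬ad (xor-path (lookup A a) (lookup A b) (lookup A c) (lookup A d) ab bc cd)

module _ {n} (A : Subset n) (k : ℕ) {S : Subset n} where

  private
    K = completeBipartite A

    side-∈ : ∀ {x} → x ∈ A → lookup A x ≡ true
    side-∈ = []=⇒lookup

    side-∁ : ∀ {x} → x ∈ ∁ A → lookup A x ≡ false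
    side-∁ {x} x∈∁A = ¬-not (λ x∈A → x∈∁p⇒x∉p x∈∁A (lookup⇒[]= x A x∈A))

  completeBipartite-dense-bound : MaxDegInduced≤ (complement K) k S → ∣ S ∣ ≤ suc k + ∣ ∁ A ∣
  completeBipartite-dense-bound sparse =
    subst (_≤ suc k + ∣ ∁ A ∣) (sym (∣p∣≡∣p∩q∣+∣p∩∁q∣ S A))
          (+-mono-≤ (∣S∩clique∣≤1+k (complement K) k sparse A-clique) (∣p∩q∣≤∣q∣ S (∁ A)))
    where
    A-clique : ∀ {u v} → u ∈ A → v ∈ A → u ≢ v → Adj (complement K) u v
    A-clique u∈A v∈A u≢v = Adj-complement⁺ K u≢v (cong₂ _xor_ (side-∈ u∈A) (side-∈ v∈A))

  completeBipartite-sparse-bound : MaxDegInduced≤ K k S → ∣ S ∣ ≤ ∣ A ∣ ⊎ ∣ S ∣ ≤ k + ∣ ∁ A ∣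
  completeBipartite-sparse-bound sparse with nonempty? (S ∩ ∁ A)
  ... | no empty = inj₁ (begin
        ∣ S ∣                          ≡⟨ ∣p∣≡∣p∩q∣+∣p∩∁q∣ S A ⟩
        ∣ S ∩ A ∣ + ∣ S ∩ ∁ A ∣        ≡⟨ cong (λ X → ∣ S ∩ A ∣ + ∣ X ∣) (Empty-unique empty) ⟩
        ∣ S ∩ A ∣ + ∣ ∅ {n} ∣          ≡⟨ cong (∣ S ∩ A ∣ +_) (∣⊥∣≡0 n) ⟩
        ∣ S ∩ A ∣ + 0                  ≡⟨ +-identityʳ _ ⟩
        ∣ S ∩ A ∣                      ≤⟨ ∣p∩q∣≤∣q∣ S A ⟩
        ∣ A ∣                          ∎)
    where open ≤-Reasoning
  ... | yes (w , w∈S∩∁A) = inj₂ (subst (_≤ k + ∣ ∁ A ∣) (sym (∣p∣≡∣p∩q∣+∣p∩∁q∣ S A))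
          (+-mono-≤ (∣neighbours∣≤k K k sparse (proj₁ (x∈p∩q⁻ S (∁ A) w∈S∩∁A))
                                       (λ u∈ → proj₁ (x∈p∩q⁻ S A u∈)) w-A)
                    (∣p∩q∣≤∣q∣ S (∁ A))))
    where
    w-A : ∀ {u} → u ∈ S ∩ A → Adj K w u
    w-A u∈ = cong₂ _xor_ (side-∁ (proj₂ (x∈p∩q⁻ S (∁ A) w∈S∩∁A))) (side-∈ (proj₂ (x∈p∩q⁻ S A u∈)))

∣p∣≡a⇒∣∁p∣≡b : ∀ {a b} {p : Subset (a + b)} → ∣ p ∣ ≡ a → ∣ ∁ p ∣ ≡ b
∣p∣≡a⇒∣∁p∣≡b {a} {b} {p} ∣p∣≡a = trans (∣∁p∣≡n∸∣p∣ p) (trans (cong (a + b ∸_) ∣p∣≡a) (m+n∸m≡n a b))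

d+[k+2]≡2+[k+d] : ∀ k d → d + (k + 2) ≡ suc (suc (k + d))
d+[k+2]≡2+[k+d] = solve-∀

completeBipartite-refutes : ∀ {k i j} p d → p < j → k + d < j → d + (k + 2) ≤ i → ¬ RamseyProperty k i j (p + d)
completeBipartite-refutes {k} {i} p d p<j k+d<j d+c≤i ramsey
  with subset-of-size ⊤ p (subst (p ≤_) (sym (∣⊤∣≡n (p + d))) (m≤m+n p d))
... | A , _ , ∣A∣≡p with ramsey (completeBipartite A) (completeBipartite-cograph A)
... | inj₁ (S , ∣S∣≡i , dense) =
      <⇒≱ (subst (_≤ i) (d+[k+2]≡2+[k+d] k d) d+c≤i)
          (subst₂ _≤_ ∣S∣≡i (cong (suc k +_) (∣p∣≡a⇒∣∁p∣≡b {p = A} ∣A∣≡p)) (completeBipartite-dense-bound A k dense))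
... | inj₂ (S , ∣S∣≡j , sparse) =
      [ (λ ∣S∣≤∣A∣ → <⇒≱ p<j (subst₂ _≤_ ∣S∣≡j ∣A∣≡p ∣S∣≤∣A∣))
      , (λ ∣S∣≤k+∣∁A∣ → <⇒≱ k+d<j (subst₂ _≤_ ∣S∣≡j (cong (k +_) (∣p∣≡a⇒∣∁p∣≡b {p = A} ∣A∣≡p)) ∣S∣≤k+∣∁A∣)) ]′
      (completeBipartite-sparse-bound A k sparse)

lower-bound-sizes : ∀ {k i j n} → k + 2 ≤ i → k + 2 ≤ j → i ≤ suc j → n + (k + 2) < i + j →
  Σ[ p ∈ ℕ ] Σ[ d ∈ ℕ ] n ≡ p + d × p < j × k + d < j × d + (k + 2) ≤ i
lower-bound-sizes {k} {j = zero} _ k+2≤0 _ _ = contradiction (≤-trans (m≤n+m 2 k) k+2≤0) λ ()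
lower-bound-sizes {k} {i} {suc j₁} {n} k+2≤i k+2≤j i≤2+j₁ n+c<i+j with n <? suc j₁
... | yes n<j = n , 0 , sym (+-identityʳ n) , n<j
              , subst (_< suc j₁) (sym (+-identityʳ k)) (<-≤-trans (m<m+n k (s≤s z≤n)) k+2≤j) , k+2≤i
... | no n≮j = j₁ , d , sym (m+[n∸m]≡n j₁≤n) , ≤-refl , s≤s k+d≤j₁ , d+c≤i
  where
  j₁≤n = <⇒≤ (≮⇒≥ n≮j)
  d = n ∸ j₁
  d+c≤i : d + (k + 2) ≤ i
  d+c≤i = +-cancelˡ-≤ j₁ (d + (k + 2)) i (≤-pred (begin
    suc (j₁ + (d + (k + 2)))  ≡⟨ cong suc (+-assoc j₁ d (k + 2)) ⟨
    suc ((j₁ + d) + (k + 2))  ≡⟨ cong (λ m → suc (m + (k + 2))) (m+[n∸m]≡n j₁≤n) ⟩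
    suc (n + (k + 2))         ≤⟨ n+c<i+j ⟩
    i + suc j₁                ≡⟨ +-suc i j₁ ⟩
    suc (i + j₁)              ≡⟨ cong suc (+-comm i j₁) ⟩
    suc (j₁ + i)              ∎))
    where open ≤-Reasoning
  k+d≤j₁ : k + d ≤ j₁
  k+d≤j₁ = ≤-pred (≤-pred (subst (_≤ suc (suc j₁)) (d+[k+2]≡2+[k+d] k d) (≤-trans d+c≤i i≤2+j₁)))

RamseyProperty-swap : ∀ {k i j n} → RamseyProperty k i j n → RamseyProperty k j i n
RamseyProperty-swap ramsey G cograph =
  swap (map₁ (HasSparseSet-complement² G) (ramsey (complement G) (complement-cograph G cograph)))

ordered-cograph-ramsey-lower : ∀ {k i j n} → k + 2 ≤ i → k + 2 ≤ j → i ≤ suc j → n + (k + 2) < i + j →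
  ¬ RamseyProperty k i j n
ordered-cograph-ramsey-lower {k} {i} {j} k+2≤i k+2≤j i≤1+j n+c<i+j
  with lower-bound-sizes k+2≤i k+2≤j i≤1+j n+c<i+j
... | p , d , n≡p+d , p<j , k+d<j , d+c≤i =
      subst (λ n → ¬ RamseyProperty k i j n) (sym n≡p+d) (completeBipartite-refutes p d p<j k+d<j d+c≤i)

cograph-ramsey-lower : ∀ {k i j n} → k + 2 ≤ i → k + 2 ≤ j → n + (k + 2) < i + j → ¬ RamseyProperty k i j n
cograph-ramsey-lower {k} {i} {j} {n} k+2≤i k+2≤j n+c<i+j with i ≤? suc j
... | yes i≤1+j = ordered-cograph-ramsey-lower k+2≤i k+2≤j i≤1+j n+c<i+j
... | no  i≰1+j = ordered-cograph-ramsey-lower k+2≤j k+2≤i j≤1+i (subst (n + (k + 2) <_) (+-comm i j) n+c<i+j)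
                  ∘ RamseyProperty-swap
  where
  j≤1+i : j ≤ suc i
  j≤1+i = ≤-trans (n≤1+n j) (≤-trans (<⇒≤ (≰⇒> i≰1+j)) (n≤1+n i))

lemma7p2 : (k i j : ℕ) → k + 2 ≤ i → i ≤ 2 * k + 2 → k + 2 ≤ j → j ≤ 2 * k + 2 →
    RamseyCO≡ k i j (i + j ∸ (k + 2))
lemma7p2 k i j k+2≤i i≤2k+2 k+2≤j j≤2k+2 =
    cograph-ramsey-upper (k+2≤i , i≤2k+2) (k+2≤j , j≤2k+2) (≤-reflexive (sym [i+j∸c]+c≡i+j))
  , λ n n<i+j∸c → cograph-ramsey-lower k+2≤i k+2≤j (subst (n + (k + 2) <_) [i+j∸c]+c≡i+j (+-monoˡ-< (k + 2) n<i+j∸c))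
  where
  [i+j∸c]+c≡i+j : (i + j ∸ (k + 2)) + (k + 2) ≡ i + j
  [i+j∸c]+c≡i+j = m∸n+n≡m (≤-trans k+2≤i (m≤m+n i j))
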